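{- For every set of formulas $\Gamma$, formula $A$ and derivation $\Pi \colon \Gamma \vdash A$ in $\mathsf{NK}$, there exist a derivation $\Pi' \colon \Gamma^{\mathsf{m}} \vdash A^{\mathsf{m}}$ in $\mathsf{NK} \setminus \{\to_\mathsf{i}, \forall_\mathsf{i}\}$ and a derivation $\Pi'' \colon \Gamma^{\mathsf{j}} \vdash A^{\mathsf{j}}$ in $\mathsf{NK} \setminus \{\forall_\mathsf{i}\}$.
   Context: First-order language with connectives $\top,\bot,\lnot,\land,\lor,\to$ and quantifiers $\forall,\exists$; negation $\lnot$ is primitive. Natural deduction rules: $\mathsf{raa}$ (from $\bot$ infer $A$, discharging any number, possibly zero, of assumptions $\lnot A$); $\mathsf{efq}$ (from $\bot$ infer $A$; the special case of $\mathsf{raa}$ discharging nothing); $\top_\mathsf{i}$; $\lnot_\mathsf{i}$ (from $\bot$ infer $\lnot A$ discharging $A$); $\lnot_\mathsf{e}$ (from $\lnot A$ and $A$ infer $\bot$); $\to_\mathsf{i}$, $\to_\mathsf{e}$, $\land_\mathsf{i}$, $\land_{\mathsf{e}_1}$, $\land_{\mathsf{e}_2}$, $\lor_{\mathsf{i}_1}$, $\lor_{\mathsf{i}_2}$, $\lor_\mathsf{e}$, $\forall_\mathsf{i}$, $\forall_\mathsf{e}$, $\exists_\mathsf{i}$, $\exists_\mathsf{e}$ as usual in Prawitz-style natural deduction (with the usual eigenvariable conditions; discharging rules may discharge any number of assumptions). $\mathsf{NM}$ is the set of all these rules except $\mathsf{raa}$ and $\mathsf{efq}$; $\mathsf{NJ}=\mathsf{NM}\cup\{\mathsf{efq}\}$;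 $\mathsf{NK}=\mathsf{NM}\cup\{\mathsf{raa}\}$; $\mathsf{NK}\setminus S$ is $\mathsf{NK}$ with the rules in $S$ removed. $\Pi\colon\Gamma\vdash A$ means $\Pi$ has conclusion $A$ and all undischarged assumptions are occurrences of formulas in $\Gamma$. The translations $(\cdot)^{\mathsf{m}}$ and $(\cdot)^{\mathsf{j}}$ are defined by induction: atomic formulas $P(t_1,\dots,t_n)$, $\top$, $\bot$ are left unchanged; $(A\land B)^\ast = A^\ast\land B^\ast$, $(A\lor B)^\ast = A^\ast\lor B^\ast$, $(\lnot A)^\ast=\lnot A^\ast$, $(\exists x A)^\ast = \exists x A^\ast$, $(\forall x A)^\ast = \lnot\exists x\lnot A^\ast$ for $\ast\in\{\mathsf{m},\mathsf{j}\}$; and $(A\to B)^{\mathsf{m}} = \lnot A^{\mathsf{m}}\lor B^{\mathsf{m}}$, $(A\to B)^{\mathsf{j}} = A^{\mathsf{j}}\to B^{\mathsf{j}}$. For a set $\Gamma$, $\Gamma^\ast=\{A^\ast \mid A\in\Gamma\}$. -}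

module Defs where

open import Data.Nat using (ℕ; zero; suc)
open import Data.Vec using (Vec; []; _∷_)
open import Data.List using (List; []; _∷_)
open import Data.List.Membership.Propositional using (_∈_)
open import Data.Product using (Σ; ∃; _×_; _,_)
open import Data.Sum using (_⊎_)
open import Relation.Binary.PropositionalEquality using (_≡_; _≢_)
open import Relation.Nullary using (¬_)
open import Level using (Level) renaming (suc to lsuc; zero to lzero)

record Signature : Set₁ where
  field
    Fun    : Set
    funAr  : Fun → ℕ
    Pred   : Set
    predAr : Pred → ℕ

module Language (S : Signature) where
  open Signature S

  -- Terms; variables are de Bruijn indices (free variables are the
  -- indices not bound inside the formula).
  data Term : Set where
    var : ℕ → Term
    fn  : (f : Fun) → Vec Term (funAr f) → Term

  infixr 6 _⇒_
  infixr 7 _∨'_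
  infixr 8 _∧'_
  data Formula : Set where
    atom : (p : Pred) → Vec Term (predAr p) → Formula
    ⊤' ⊥' : Formula
    ¬'    : Formula → Formula
    _∧'_ _∨'_ _⇒_ : Formula → Formula → Formula
    ∀' ∃' : Formula → Formula   -- binds de Bruijn index 0

  mutual
    renT : (ℕ → ℕ) → Term → Term
    renT ρ (var x)   = var (ρ x)
    renT ρ (fn f ts) = fn f (renTs ρ ts)

    renTs : ∀ {n} → (ℕ → ℕ) → Vec Term n → Vec Term n
    renTs ρ []       = []
    renTs ρ (t ∷ ts) = renT ρ t ∷ renTs ρ ts

  liftR : (ℕ → ℕ) → ℕ → ℕ
  liftR ρ zero    = zero
  liftR ρ (suc x) = suc (ρ x)

  renF : (ℕ → ℕ) → Formula → Formula
  renF ρ (atom p ts) = atom p (renTs ρ ts)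
  renF ρ ⊤'          = ⊤'
  renF ρ ⊥'          = ⊥'
  renF ρ (¬' A)      = ¬' (renF ρ A)
  renF ρ (A ∧' B)    = renF ρ A ∧' renF ρ B
  renF ρ (A ∨' B)    = renF ρ A ∨' renF ρ B
  renF ρ (A ⇒ B)     = renF ρ A ⇒ renF ρ B
  renF ρ (∀' A)      = ∀' (renF (liftR ρ) A)
  renF ρ (∃' A)      = ∃' (renF (liftR ρ) A)

  wk : Formula → Formula
  wk = renF suc

  mutual
    subT : (ℕ → Term) → Term → Term
    subT σ (var x)   = σ x
    subT σ (fn f ts) = fn f (subTs σ ts)

    subTs : ∀ {n} → (ℕ → Term) → Vec Term n → Vec Term n
    subTs σ []       = []
    subTs σ (t ∷ ts) = subT σ t ∷ subTs σ ts

  liftS : (ℕ → Term) → ℕ → Term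
  liftS σ zero    = var zero
  liftS σ (suc x) = renT suc (σ x)

  subF : (ℕ → Term) → Formula → Formula
  subF σ (atom p ts) = atom p (subTs σ ts)
  subF σ ⊤'          = ⊤'
  subF σ ⊥'          = ⊥'
  subF σ (¬' A)      = ¬' (subF σ A)
  subF σ (A ∧' B)    = subF σ A ∧' subF σ B
  subF σ (A ∨' B)    = subF σ A ∨' subF σ B
  subF σ (A ⇒ B)     = subF σ A ⇒ subF σ B
  subF σ (∀' A)      = ∀' (subF (liftS σ) A)
  subF σ (∃' A)      = ∃' (subF (liftS σ) A)

  -- A [ t ] : instantiate bound variable 0 by t (other indices shift down)
  single : Term → ℕ → Term
  single t zero    = t
  single t (suc x) = var x

  _[_] : Formula → Term → Formula
  A [ t ] = subF (single t) A

  FSet : Set₁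
  FSet = Formula → Set

  _,,_ : FSet → Formula → FSet
  (Γ ,, A) B = Γ B ⊎ B ≡ A

  wkSet : FSet → FSet
  wkSet Γ B = ∃ λ C → Γ C × B ≡ wk C

  image : (Formula → Formula) → FSet → FSet
  image f Γ B = ∃ λ C → Γ C × B ≡ f C

  data Rule : Set where
    raa efq ⊤i ¬i ¬e →i →e ∧i ∧e₁ ∧e₂ ∨i₁ ∨i₂ ∨e ∀i ∀e ∃i ∃e : Rule

  RuleSet : Set₁
  RuleSet = Rule → Set

  NM : RuleSet
  NM r = r ≢ raa × r ≢ efq

  NJ : RuleSet
  NJ r = NM r ⊎ r ≡ efq

  NK : RuleSet
  NK r = NM r ⊎ r ≡ raa

  _∖_ : RuleSet → List Rule → RuleSet
  (R ∖ S) r = R r × ¬ (r ∈ S)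

  -- Prawitz-style natural deduction, in context form:
  -- Der R Γ A  = derivations using only rules in R, with conclusion A,
  -- all undischarged assumptions being occurrences of formulas in Γ.
  -- Discharging rules extend the context by the discharged formula
  -- (so any number, possibly zero, of occurrences may be discharged).
  -- Eigenvariable conditions are realised with de Bruijn indices:
  -- the eigenvariable is index 0, fresh w.r.t. the weakened context.

  data Der (R : RuleSet) : FSet → Formula → Set₁ where
    ass  : ∀ {Γ A} → Γ A → Der R Γ A
    raaR : ∀ {Γ A} → R raa → Der R (Γ ,, ¬' A) ⊥' → Der R Γ A
    efqR : ∀ {Γ A} → R efq → Der R Γ ⊥' → Der R Γ A
    ⊤I   : ∀ {Γ} → R ⊤i → Der R Γ ⊤'
    ¬I   : ∀ {Γ A} → R ¬i → Der R (Γ ,, A) ⊥' → Der R Γ (¬' A)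
    ¬E   : ∀ {Γ A} → R ¬e → Der R Γ (¬' A) → Der R Γ A → Der R Γ ⊥'
    ⇒I   : ∀ {Γ A B} → R →i → Der R (Γ ,, A) B → Der R Γ (A ⇒ B)
    ⇒E   : ∀ {Γ A B} → R →e → Der R Γ (A ⇒ B) → Der R Γ A → Der R Γ B
    ∧I   : ∀ {Γ A B} → R ∧i → Der R Γ A → Der R Γ B → Der R Γ (A ∧' B)
    ∧E₁  : ∀ {Γ A B} → R ∧e₁ → Der R Γ (A ∧' B) → Der R Γ A
    ∧E₂  : ∀ {Γ A B} → R ∧e₂ → Der R Γ (A ∧' B) → Der R Γ B
    ∨I₁  : ∀ {Γ A B} → R ∨i₁ → Der R Γ A → Der R Γ (A ∨' B)
    ∨I₂  : ∀ {Γ A B} → R ∨i₂ → Der R Γ B → Der R Γ (A ∨' B)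
    ∨E   : ∀ {Γ A B C} → R ∨e → Der R Γ (A ∨' B)
         → Der R (Γ ,, A) C → Der R (Γ ,, B) C → Der R Γ C
    ∀I   : ∀ {Γ A} → R ∀i → Der R (wkSet Γ) A → Der R Γ (∀' A)
    ∀E   : ∀ {Γ A} → R ∀e → (t : Term) → Der R Γ (∀' A) → Der R Γ (A [ t ])
    ∃I   : ∀ {Γ A} → R ∃i → (t : Term) → Der R Γ (A [ t ]) → Der R Γ (∃' A)
    ∃E   : ∀ {Γ A C} → R ∃e → Der R Γ (∃' A)
         → Der R (wkSet Γ ,, A) (wk C) → Der R Γ C

  _ᵐ : Formula → Formula
  atom p ts ᵐ = atom p ts
  ⊤' ᵐ        = ⊤'
  ⊥' ᵐ        = ⊥'
  ¬' A ᵐ      = ¬' (A ᵐ)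
  (A ∧' B) ᵐ  = (A ᵐ) ∧' (B ᵐ)
  (A ∨' B) ᵐ  = (A ᵐ) ∨' (B ᵐ)
  (A ⇒ B) ᵐ   = ¬' (A ᵐ) ∨' (B ᵐ)
  ∀' A ᵐ      = ¬' (∃' (¬' (A ᵐ)))
  ∃' A ᵐ      = ∃' (A ᵐ)

  _ʲ : Formula → Formula
  atom p ts ʲ = atom p ts
  ⊤' ʲ        = ⊤'
  ⊥' ʲ        = ⊥'
  ¬' A ʲ      = ¬' (A ʲ)
  (A ∧' B) ʲ  = (A ʲ) ∧' (B ʲ)
  (A ∨' B) ʲ  = (A ʲ) ∨' (B ʲ)
  (A ⇒ B) ʲ   = (A ʲ) ⇒ (B ʲ)
  ∀' A ʲ      = ¬' (∃' (¬' (A ʲ)))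
  ∃' A ʲ      = ∃' (A ʲ)

-- Both translations keep ¬, ∧, ∨, ∃ and replace ∀x A by ¬∃x¬A, so a derivation
-- can be translated rule by rule using only raa and the rules of ⊤, ¬, ∧, ∨, ∃.
-- ∀-introduction becomes ¬-introduction around an ∃-elimination, ∀-elimination
-- becomes raa on ¬A[t] with ∃-introduction, and efq is raa discharging nothing.
-- Implication is kept by (·)ʲ; for (·)ᵐ it becomes ¬A ∨ B, which is introduced
-- classically (raa on ¬(¬A ∨ B)) and eliminated by disjunctive syllogism.
-- No ∀-introduction is ever produced, and no →-introduction for (·)ᵐ.
module Submission where

open import Defs
open import Data.List using (_∷_; [])
open import Data.List.Relation.Unary.All as All using (All; _∷_; [])
open import Data.List.Relation.Unary.Any using (here; there)
open import Data.Nat using (suc)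
open import Data.Product using (_×_; _,_)
open import Data.Sum using (inj₁; inj₂)
open import Relation.Binary.PropositionalEquality using (_≡_; refl; sym; trans; cong; cong₂; subst)
open import Relation.Nullary using (¬_)

module _ (S : Signature) where
  open Language S

  -- A record rather than a function type, so that Γ and Δ stay inferable.
  record _⊆_ (Γ Δ : FSet) : Set where
    constructor included
    field ∈-⊆ : ∀ {C} → Γ C → Δ C
  open _⊆_

  ⊆-extend : ∀ {Γ A} → Γ ⊆ (Γ ,, A)
  ⊆-extend = included inj₁

  ⊆-trans : ∀ {Γ Δ Θ} → Γ ⊆ Δ → Δ ⊆ Θ → Γ ⊆ Θ
  ⊆-trans Γ⊆Δ Δ⊆Θ = included λ γ → ∈-⊆ Δ⊆Θ (∈-⊆ Γ⊆Δ γ)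

  ⊆-,, : ∀ {Γ Δ A} → Γ ⊆ Δ → (Γ ,, A) ⊆ (Δ ,, A)
  ⊆-,, Γ⊆Δ = included λ { (inj₁ γ) → inj₁ (∈-⊆ Γ⊆Δ γ) ; (inj₂ eq) → inj₂ eq }

  wkSet-mono : ∀ {Γ Δ} → Γ ⊆ Δ → wkSet Γ ⊆ wkSet Δ
  wkSet-mono Γ⊆Δ = included λ { (C , γ , eq) → C , ∈-⊆ Γ⊆Δ γ , eq }

  weaken : ∀ {R Γ Δ A} → Γ ⊆ Δ → Der R Γ A → Der R Δ A
  weaken Γ⊆Δ (ass γ)        = ass (∈-⊆ Γ⊆Δ γ)
  weaken Γ⊆Δ (raaR r d)     = raaR r (weaken (⊆-,, Γ⊆Δ) d)
  weaken Γ⊆Δ (efqR r d)     = efqR r (weaken Γ⊆Δ d)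
  weaken Γ⊆Δ (⊤I r)         = ⊤I r
  weaken Γ⊆Δ (¬I r d)       = ¬I r (weaken (⊆-,, Γ⊆Δ) d)
  weaken Γ⊆Δ (¬E r d e)     = ¬E r (weaken Γ⊆Δ d) (weaken Γ⊆Δ e)
  weaken Γ⊆Δ (⇒I r d)       = ⇒I r (weaken (⊆-,, Γ⊆Δ) d)
  weaken Γ⊆Δ (⇒E r d e)     = ⇒E r (weaken Γ⊆Δ d) (weaken Γ⊆Δ e)
  weaken Γ⊆Δ (∧I r d e)     = ∧I r (weaken Γ⊆Δ d) (weaken Γ⊆Δ e)
  weaken Γ⊆Δ (∧E₁ r d)      = ∧E₁ r (weaken Γ⊆Δ d)
  weaken Γ⊆Δ (∧E₂ r d)      = ∧E₂ r (weaken Γ⊆Δ d)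
  weaken Γ⊆Δ (∨I₁ r d)      = ∨I₁ r (weaken Γ⊆Δ d)
  weaken Γ⊆Δ (∨I₂ r d)      = ∨I₂ r (weaken Γ⊆Δ d)
  weaken Γ⊆Δ (∨E r d e f)   = ∨E r (weaken Γ⊆Δ d) (weaken (⊆-,, Γ⊆Δ) e) (weaken (⊆-,, Γ⊆Δ) f)
  weaken Γ⊆Δ (∀I r d)       = ∀I r (weaken (wkSet-mono Γ⊆Δ) d)
  weaken Γ⊆Δ (∀E r t d)     = ∀E r t (weaken Γ⊆Δ d)
  weaken Γ⊆Δ (∃I r t d)     = ∃I r t (weaken Γ⊆Δ d)
  weaken Γ⊆Δ (∃E r d e)     = ∃E r (weaken Γ⊆Δ d) (weaken (⊆-,, (wkSet-mono Γ⊆Δ)) e)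

  image-,, : ∀ {f Γ A} → image f (Γ ,, A) ⊆ (image f Γ ,, f A)
  image-,, = included λ
    { (C , inj₁ γ , eq)    → inj₁ (C , γ , eq)
    ; (C , inj₂ refl , eq) → inj₂ eq
    }

  image-wkSet : ∀ {f Γ} → (∀ C → wk (f C) ≡ f (wk C)) → image f (wkSet Γ) ⊆ wkSet (image f Γ)
  image-wkSet {f} f-wk = included λ
    { (_ , (C , γ , refl) , refl) → f C , (C , γ , refl) , sym (f-wk C) }

  image-cong : ∀ {f g Γ} → (∀ A → f A ≡ g A) → image f Γ ⊆ image g Γ
  image-cong f≗g = included λ { (C , γ , refl) → C , γ , f≗g C }

  data Core : RuleSet where
    raa : Core raa
    ⊤i  : Core ⊤i
    ¬i  : Core ¬i
    ¬e  : Core ¬e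
    ∧i  : Core ∧i
    ∧e₁ : Core ∧e₁
    ∧e₂ : Core ∧e₂
    ∨i₁ : Core ∨i₁
    ∨i₂ : Core ∨i₂
    ∨e  : Core ∨e
    ∃i  : Core ∃i
    ∃e  : Core ∃e

  Core⊆NK : ∀ {r} → Core r → NK r
  Core⊆NK raa = inj₂ refl
  Core⊆NK ⊤i  = inj₁ ((λ ()) , (λ ()))
  Core⊆NK ¬i  = inj₁ ((λ ()) , (λ ()))
  Core⊆NK ¬e  = inj₁ ((λ ()) , (λ ()))
  Core⊆NK ∧i  = inj₁ ((λ ()) , (λ ()))
  Core⊆NK ∧e₁ = inj₁ ((λ ()) , (λ ()))
  Core⊆NK ∧e₂ = inj₁ ((λ ()) , (λ ()))
  Core⊆NK ∨i₁ = inj₁ ((λ ()) , (λ ()))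
  Core⊆NK ∨i₂ = inj₁ ((λ ()) , (λ ()))
  Core⊆NK ∨e  = inj₁ ((λ ()) , (λ ()))
  Core⊆NK ∃i  = inj₁ ((λ ()) , (λ ()))
  Core⊆NK ∃e  = inj₁ ((λ ()) , (λ ()))

  Core⊆NK∖ : ∀ {rs r} → All (λ r → ¬ Core r) rs → Core r → (NK ∖ rs) r
  Core⊆NK∖ disjoint c = Core⊆NK c , λ r∈rs → All.lookup disjoint r∈rs c

  module _ {R : RuleSet} (core : ∀ {r} → Core r → R r) where

    efq-by-raa : ∀ {Γ A} → Der R Γ ⊥' → Der R Γ A
    efq-by-raa d = raaR (core raa) (weaken ⊆-extend d)

    ¬∨-intro : ∀ {Γ A B} → Der R (Γ ,, A) B → Der R Γ (¬' A ∨' B)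
    ¬∨-intro d =
      raaR (core raa) (¬E (core ¬e) (ass (inj₂ refl))
        (∨I₁ (core ∨i₁) (¬I (core ¬i) (¬E (core ¬e) (ass (inj₁ (inj₂ refl)))
          (∨I₂ (core ∨i₂) (weaken (⊆-,, ⊆-extend) d))))))

    ¬∨-elim : ∀ {Γ A B} → Der R Γ (¬' A ∨' B) → Der R Γ A → Der R Γ B
    ¬∨-elim d e =
      ∨E (core ∨e) d
        (efq-by-raa (¬E (core ¬e) (ass (inj₂ refl)) (weaken ⊆-extend e)))
        (ass (inj₂ refl))

  module Translation
      (_⊃_ : Formula → Formula → Formula)
      (⊃-ren : ∀ ρ A B → renF ρ (A ⊃ B) ≡ renF ρ A ⊃ renF ρ B)
      (⊃-sub : ∀ σ A B → subF σ (A ⊃ B) ≡ subF σ A ⊃ subF σ B)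
    where

    ⟦_⟧ : Formula → Formula
    ⟦ atom p ts ⟧ = atom p ts
    ⟦ ⊤' ⟧        = ⊤'
    ⟦ ⊥' ⟧        = ⊥'
    ⟦ ¬' A ⟧      = ¬' ⟦ A ⟧
    ⟦ A ∧' B ⟧    = ⟦ A ⟧ ∧' ⟦ B ⟧
    ⟦ A ∨' B ⟧    = ⟦ A ⟧ ∨' ⟦ B ⟧
    ⟦ A ⇒ B ⟧     = ⟦ A ⟧ ⊃ ⟦ B ⟧
    ⟦ ∀' A ⟧      = ¬' (∃' (¬' ⟦ A ⟧))
    ⟦ ∃' A ⟧      = ∃' ⟦ A ⟧

    ⟦⟧-ren : ∀ ρ A → renF ρ ⟦ A ⟧ ≡ ⟦ renF ρ A ⟧
    ⟦⟧-ren ρ (atom p ts) = refl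
    ⟦⟧-ren ρ ⊤'          = refl
    ⟦⟧-ren ρ ⊥'          = refl
    ⟦⟧-ren ρ (¬' A)      = cong ¬' (⟦⟧-ren ρ A)
    ⟦⟧-ren ρ (A ∧' B)    = cong₂ _∧'_ (⟦⟧-ren ρ A) (⟦⟧-ren ρ B)
    ⟦⟧-ren ρ (A ∨' B)    = cong₂ _∨'_ (⟦⟧-ren ρ A) (⟦⟧-ren ρ B)
    ⟦⟧-ren ρ (A ⇒ B)     = trans (⊃-ren ρ ⟦ A ⟧ ⟦ B ⟧) (cong₂ _⊃_ (⟦⟧-ren ρ A) (⟦⟧-ren ρ B))
    ⟦⟧-ren ρ (∀' A)      = cong (λ A′ → ¬' (∃' (¬' A′))) (⟦⟧-ren (liftR ρ) A)
    ⟦⟧-ren ρ (∃' A)      = cong ∃' (⟦⟧-ren (liftR ρ) A)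

    ⟦⟧-sub : ∀ σ A → subF σ ⟦ A ⟧ ≡ ⟦ subF σ A ⟧
    ⟦⟧-sub σ (atom p ts) = refl
    ⟦⟧-sub σ ⊤'          = refl
    ⟦⟧-sub σ ⊥'          = refl
    ⟦⟧-sub σ (¬' A)      = cong ¬' (⟦⟧-sub σ A)
    ⟦⟧-sub σ (A ∧' B)    = cong₂ _∧'_ (⟦⟧-sub σ A) (⟦⟧-sub σ B)
    ⟦⟧-sub σ (A ∨' B)    = cong₂ _∨'_ (⟦⟧-sub σ A) (⟦⟧-sub σ B)
    ⟦⟧-sub σ (A ⇒ B)     = trans (⊃-sub σ ⟦ A ⟧ ⟦ B ⟧) (cong₂ _⊃_ (⟦⟧-sub σ A) (⟦⟧-sub σ B))
    ⟦⟧-sub σ (∀' A)      = cong (λ A′ → ¬' (∃' (¬' A′))) (⟦⟧-sub (liftS σ) A)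
    ⟦⟧-sub σ (∃' A)      = cong ∃' (⟦⟧-sub (liftS σ) A)

    module _
        {R : RuleSet} (core : ∀ {r} → Core r → R r)
        (⊃-intro : ∀ {Γ A B} → Der R (Γ ,, A) B → Der R Γ (A ⊃ B))
        (⊃-elim : ∀ {Γ A B} → Der R Γ (A ⊃ B) → Der R Γ A → Der R Γ B)
      where

      translate : ∀ {R′ Γ A} → Der R′ Γ A → Der R (image ⟦_⟧ Γ) ⟦ A ⟧
      translate (ass γ)      = ass (_ , γ , refl)
      translate (raaR _ d)   = raaR (core raa) (weaken image-,, (translate d))
      translate (efqR _ d)   = efq-by-raa core (translate d)
      translate (⊤I _)       = ⊤I (core ⊤i)
      translate (¬I _ d)     = ¬I (core ¬i) (weaken image-,, (translate d))
      translate (¬E _ d e)   = ¬E (core ¬e) (translate d) (translate e)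
      translate (⇒I _ d)     = ⊃-intro (weaken image-,, (translate d))
      translate (⇒E _ d e)   = ⊃-elim (translate d) (translate e)
      translate (∧I _ d e)   = ∧I (core ∧i) (translate d) (translate e)
      translate (∧E₁ _ d)    = ∧E₁ (core ∧e₁) (translate d)
      translate (∧E₂ _ d)    = ∧E₂ (core ∧e₂) (translate d)
      translate (∨I₁ _ d)    = ∨I₁ (core ∨i₁) (translate d)
      translate (∨I₂ _ d)    = ∨I₂ (core ∨i₂) (translate d)
      translate (∨E _ d e f) =
        ∨E (core ∨e) (translate d) (weaken image-,, (translate e)) (weaken image-,, (translate f))
      translate (∀I _ d)     =
        ¬I (core ¬i) (∃E (core ∃e) (ass (inj₂ refl))
          (¬E (core ¬e) (ass (inj₂ refl))
            (weaken (⊆-trans (image-wkSet (⟦⟧-ren suc)) (⊆-trans (wkSet-mono ⊆-extend) ⊆-extend))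
              (translate d))))
      translate (∀E {A = A} _ t d) =
        subst (Der R _) (⟦⟧-sub (single t) A)
          (raaR (core raa) (¬E (core ¬e) (weaken ⊆-extend (translate d))
            (∃I (core ∃i) t (ass (inj₂ refl)))))
      translate (∃I {A = A} _ t d) =
        ∃I (core ∃i) t (subst (Der R _) (sym (⟦⟧-sub (single t) A)) (translate d))
      translate (∃E {C = C} _ d e) =
        ∃E (core ∃e) (translate d)
          (subst (Der R _) (sym (⟦⟧-ren suc C))
            (weaken (⊆-trans image-,, (⊆-,, (image-wkSet (⟦⟧-ren suc)))) (translate e)))

  module Material = Translation (λ A B → ¬' A ∨' B) (λ _ _ _ → refl) (λ _ _ _ → refl)
  module Intuitionistic = Translation _⇒_ (λ _ _ _ → refl) (λ _ _ _ → refl)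

  ᵐ≗⟦⟧ : ∀ A → A ᵐ ≡ Material.⟦ A ⟧
  ᵐ≗⟦⟧ (atom p ts) = refl
  ᵐ≗⟦⟧ ⊤'          = refl
  ᵐ≗⟦⟧ ⊥'          = refl
  ᵐ≗⟦⟧ (¬' A)      = cong ¬' (ᵐ≗⟦⟧ A)
  ᵐ≗⟦⟧ (A ∧' B)    = cong₂ _∧'_ (ᵐ≗⟦⟧ A) (ᵐ≗⟦⟧ B)
  ᵐ≗⟦⟧ (A ∨' B)    = cong₂ _∨'_ (ᵐ≗⟦⟧ A) (ᵐ≗⟦⟧ B)
  ᵐ≗⟦⟧ (A ⇒ B)     = cong₂ (λ A′ B′ → ¬' A′ ∨' B′) (ᵐ≗⟦⟧ A) (ᵐ≗⟦⟧ B)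
  ᵐ≗⟦⟧ (∀' A)      = cong (λ A′ → ¬' (∃' (¬' A′))) (ᵐ≗⟦⟧ A)
  ᵐ≗⟦⟧ (∃' A)      = cong ∃' (ᵐ≗⟦⟧ A)

  ʲ≗⟦⟧ : ∀ A → A ʲ ≡ Intuitionistic.⟦ A ⟧
  ʲ≗⟦⟧ (atom p ts) = refl
  ʲ≗⟦⟧ ⊤'          = refl
  ʲ≗⟦⟧ ⊥'          = refl
  ʲ≗⟦⟧ (¬' A)      = cong ¬' (ʲ≗⟦⟧ A)
  ʲ≗⟦⟧ (A ∧' B)    = cong₂ _∧'_ (ʲ≗⟦⟧ A) (ʲ≗⟦⟧ B)
  ʲ≗⟦⟧ (A ∨' B)    = cong₂ _∨'_ (ʲ≗⟦⟧ A) (ʲ≗⟦⟧ B)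
  ʲ≗⟦⟧ (A ⇒ B)     = cong₂ _⇒_ (ʲ≗⟦⟧ A) (ʲ≗⟦⟧ B)
  ʲ≗⟦⟧ (∀' A)      = cong (λ A′ → ¬' (∃' (¬' A′))) (ʲ≗⟦⟧ A)
  ʲ≗⟦⟧ (∃' A)      = cong ∃' (ʲ≗⟦⟧ A)

  translateᵐ : ∀ {R Γ A} → Der R Γ A → Der (NK ∖ (→i ∷ ∀i ∷ [])) (image _ᵐ Γ) (A ᵐ)
  translateᵐ {A = A} d =
    subst (Der _ _) (sym (ᵐ≗⟦⟧ A))
      (weaken (image-cong (λ C → sym (ᵐ≗⟦⟧ C)))
        (Material.translate core (¬∨-intro core) (¬∨-elim core) d))
    where
    core : ∀ {r} → Core r → (NK ∖ (→i ∷ ∀i ∷ [])) r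
    core = Core⊆NK∖ ((λ ()) ∷ (λ ()) ∷ [])

  translateʲ : ∀ {R Γ A} → Der R Γ A → Der (NK ∖ (∀i ∷ [])) (image _ʲ Γ) (A ʲ)
  translateʲ {A = A} d =
    subst (Der _ _) (sym (ʲ≗⟦⟧ A))
      (weaken (image-cong (λ C → sym (ʲ≗⟦⟧ C)))
        (Intuitionistic.translate (Core⊆NK∖ ((λ ()) ∷ [])) (⇒I →i∈R) (⇒E →e∈R) d))
    where
    →i∈R : (NK ∖ (∀i ∷ [])) →i
    →i∈R = inj₁ ((λ ()) , (λ ())) , λ { (here ()) ; (there ()) }
    →e∈R : (NK ∖ (∀i ∷ [])) →e
    →e∈R = inj₁ ((λ ()) , (λ ())) , λ { (here ()) ; (there ()) }

lemma6p3 : (S : Signature) → let open Language S in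
    (Γ : FSet) (A : Formula) → Der NK Γ A →
    Der (NK ∖ (→i ∷ ∀i ∷ [])) (image _ᵐ Γ) (A ᵐ)
    × Der (NK ∖ (∀i ∷ [])) (image _ʲ Γ) (A ʲ)
lemma6p3 S Γ A d = translateᵐ S d , translateʲ S d
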